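{- Let $\mathcal N=(V,E,\omega)$ be a phylogenetic $X$-network, $\mathcal F$ a food web on $X$ with a tree extension $T_{\mathcal F}$, $x_1,\dots,x_n$ an ordering of $X$ as described in the context, $N$ a positive integer and $c:E\to[N]$ a coloring. Then for every perfect triple $(A,\chi_1,\chi_2)$ we have $$PD_{\mathcal N}(X\setminus A)\ \ge\ \sum_{e\in E}\omega(e)-\sum_{x\in A}\omega(F_{x,\chi_2(x)}),$$ where $\omega(F)=\sum_{e\in F}\omega(e)$.
   Context: A phylogenetic $X$-network $\mathcal N=(V,E,\omega)$ is a finite directed acyclic graph with edge weights $\omega:E\to\mathbb Z_{>0}$, a unique vertex of in-degree $0$ (the root), whose leaves (in-degree $1$, out-degree $0$) form the set $X$, and whose other vertices are tree vertices (in-degree $1$, out-degree $\ge2$) or reticulations (in-degree $\ge 2$, out-degree $1$). For $A\subseteq X$, $PD_{\mathcal N}(A)$ is the total weight of edges $uv$ such that some leaf of $A$ is reachable from $v$. A food web on $X$ is a directed acyclic graph on vertex set $X$; a tree extension $T_{\mathcal F}$ of it is a rooted directed tree on $X$ such that every edge $uv$ of the food web corresponds to a directed $u$–$v$ path in $T_{\mathcal F}$. The ordering $x_1,\dots,x_n$ of $X$ is a depth-first (preorder) ordering of $T_{\mathcal F}$: if $x_i$ is the parent of $x_j$ in $T_{\mathcal F}$ then $i<j$, and if $x_i,x_j$ share a parent with $i<j$ then every vertex in the subtree rooted at $x_i$ precedes every vertex in the subtree rooted at $x_j$. For a set of edges $F$, $\mathcal N[F]$ is the subgraph induced by the endpoints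 of edges in $F$ and $c(F)=\{c(e):e\in F\}$. Given $x\in X$ and $C\subseteq[N]$, $F\subseteq E$ is $(x,C)$-respecting if: (i) $F$ contains the edge entering $x$; (ii) $c(e)\notin C$ for $e\in F$; (iii) for each $uv\in F$ there is a directed path from $v$ to $x$ in $\mathcal N[F]$; (iv) there is $F'\subseteq E$ with $c(e)\in C$ for $e\in F'$, colors on $F\cup F'$ pairwise distinct, and for each $uv\in F$ exactly one of: (1) $F$ contains all edges entering $u$ and $c(e)\notin C$ for every edge $e$ leaving $u$; (2) $F$ contains no edge entering $u$ and some edge leaving $u$ lies in $F'$. Such a set is unique if it exists and is denoted $F_{x,C}$. A triple $(A,\chi_1,\chi_2)$ with $A\subseteq X$ and $\chi_1,\chi_2:A\to 2^{[N]}$ is perfect if: $\chi_i(x)\cap\chi_i(y)=\emptyset$ for all distinct $x,y\in A$ and $i\in\{1,2\}$; $\chi_1(x_i)\cap\chi_2(x_j)=\emptyset$ for all $x_i,x_j\in A$ with $i\le j$; and for each $x\in A$ the $(x,\chi_2(x))$-respecting set $F_{x,\chi_2(x)}$ exists and $\chi_1(x)=c(F_{x,\chi_2(x)})$. -}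

module Defs where

open import Data.Nat using (ℕ; zero; suc; _+_; _≤_; _<_)
open import Data.Fin using (Fin; _≟_)
import Data.Fin as F
open import Data.Fin.Subset using (Subset; _∈_; _∉_)
open import Data.Vec using (lookup)
open import Data.List using (List; length; filter; allFin; map)
open import Data.Nat.ListAction using (sum)
open import Data.List.Membership.Propositional using () renaming (_∈_ to _∈L_)
open import Data.Maybe using (Maybe; just; nothing)
open import Data.Bool using (if_then_else_)
open import Data.Product using (Σ; ∃; ∃-syntax; _×_; _,_)
open import Data.Sum using (_⊎_)
open import Relation.Nullary using (¬_)
open import Relation.Binary.PropositionalEquality using (_≡_; _≢_)

record Digraph (nv ne : ℕ) : Set where
  field
    src : Fin ne → Fin nv
    tgt : Fin ne → Fin nv
open Digraph public

data Reach {nv ne} (G : Digraph nv ne) : Fin nv → Fin nv → Set where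
  reach-refl : ∀ {u} → Reach G u u
  reach-step : ∀ {u w} (e : Fin ne) → src G e ≡ u → Reach G (tgt G e) w → Reach G u w

data ReachIn {nv ne} (G : Digraph nv ne) (P : Fin nv → Set) : Fin nv → Fin nv → Set where
  rin-refl : ∀ {u} → ReachIn G P u u
  rin-step : ∀ {u w} (e : Fin ne) → src G e ≡ u → P (src G e) → P (tgt G e) →
             ReachIn G P (tgt G e) w → ReachIn G P u w

indeg : ∀ {nv ne} → Digraph nv ne → Fin nv → ℕ
indeg {ne = ne} G v = length (filter (λ e → tgt G e ≟ v) (allFin ne))

outdeg : ∀ {nv ne} → Digraph nv ne → Fin nv → ℕ
outdeg {ne = ne} G v = length (filter (λ e → src G e ≟ v) (allFin ne))

-- Phylogenetic X-network with X = Fin n (leaf x is the vertex labelled x)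

record PhyloNetwork (nv ne n : ℕ) : Set where
  field
    graph   : Digraph nv ne
    ω       : Fin ne → ℕ
    ω-pos   : ∀ e → 0 < ω e
    simple  : ∀ e e' → src graph e ≡ src graph e' → tgt graph e ≡ tgt graph e' → e ≡ e'
    acyclic : ∀ e → ¬ Reach graph (tgt graph e) (src graph e)
    root        : Fin nv
    root-indeg  : indeg graph root ≡ 0
    root-unique : ∀ v → indeg graph v ≡ 0 → v ≡ root
    leaf        : Fin n → Fin nv
    leaf-inj    : ∀ x y → leaf x ≡ leaf y → x ≡ y
    leaf-isLeaf : ∀ x → indeg graph (leaf x) ≡ 1 × outdeg graph (leaf x) ≡ 0
    leaf-onto   : ∀ v → indeg graph v ≡ 1 → outdeg graph v ≡ 0 → ∃[ x ] leaf x ≡ v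
    kinds : ∀ v → v ≢ root →
      (indeg graph v ≡ 1 × outdeg graph v ≡ 0) ⊎
      (indeg graph v ≡ 1 × 2 ≤ outdeg graph v) ⊎
      (2 ≤ indeg graph v × outdeg graph v ≡ 1)
open PhyloNetwork public

FoodWeb : ℕ → Set
FoodWeb n = List (Fin n × Fin n)

data FWPath {n} (fw : FoodWeb n) : Fin n → Fin n → Set where
  fw-edge : ∀ {u v} → (u , v) ∈L fw → FWPath fw u v
  fw-cons : ∀ {u v w} → (u , v) ∈L fw → FWPath fw v w → FWPath fw u w

IsFoodWeb : ∀ {n} → FoodWeb n → Set
IsFoodWeb {n} fw = ∀ (v : Fin n) → ¬ FWPath fw v v

data Anc {n} (par : Fin n → Maybe (Fin n)) : Fin n → Fin n → Set where
  anc-refl : ∀ {x} → Anc par x x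
  anc-step : ∀ {x y z} → par y ≡ just z → Anc par x z → Anc par x y

ProperAnc : ∀ {n} → (Fin n → Maybe (Fin n)) → Fin n → Fin n → Set
ProperAnc par x y = ∃[ z ] (par y ≡ just z × Anc par x z)

record RootedTree (n : ℕ) : Set where
  field
    parent       : Fin n → Maybe (Fin n)
    troot        : Fin n
    troot-par    : parent troot ≡ nothing
    troot-unique : ∀ x → parent x ≡ nothing → x ≡ troot
    connected    : ∀ x → Anc parent troot x
    acyclicT     : ∀ x → ¬ ProperAnc parent x x
open RootedTree public

IsTreeExtension : ∀ {n} → FoodWeb n → RootedTree n → Set
IsTreeExtension fw T = ∀ u v → (u , v) ∈L fw → ProperAnc (parent T) u v

-- the index order of Fin n (x_i = i) is a depth-first preorder of T
IsDFSOrder : ∀ {n} → RootedTree n → Set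
IsDFSOrder T =
  (∀ i j → parent T j ≡ just i → F._<_ i j) ×
  (∀ i j p → parent T i ≡ just p → parent T j ≡ just p → F._<_ i j →
     ∀ a b → Anc (parent T) i a → Anc (parent T) j b → F._<_ a b)

weight : ∀ {ne} → (Fin ne → ℕ) → Subset ne → ℕ
weight {ne} ω S = sum (map (λ e → if lookup S e then ω e else 0) (allFin ne))

totalWeight : ∀ {ne} → (Fin ne → ℕ) → ℕ
totalWeight {ne} ω = sum (map ω (allFin ne))

-- S is exactly the set of edges uv such that some leaf of B is reachable from v,
-- so that weight ω S = PD_N(B)
IsPDEdgeSet : ∀ {nv ne n} → PhyloNetwork nv ne n → Subset n → Subset ne → Set
IsPDEdgeSet Nw B S = ∀ e →
  (e ∈ S → ∃[ y ] (y ∈ B × Reach (graph Nw) (tgt (graph Nw) e) (leaf Nw y))) ×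
  (∃[ y ] (y ∈ B × Reach (graph Nw) (tgt (graph Nw) e) (leaf Nw y)) → e ∈ S)

Endpoint : ∀ {nv ne} → Digraph nv ne → Subset ne → Fin nv → Set
Endpoint G F w = ∃[ e ] (e ∈ F × (src G e ≡ w ⊎ tgt G e ≡ w))

ExactlyOne : Set → Set → Set
ExactlyOne P Q = (P × ¬ Q) ⊎ (¬ P × Q)

Respecting : ∀ {nv ne n N} → PhyloNetwork nv ne n → (Fin ne → Fin N) →
             Fin n → Subset N → Subset ne → Set
Respecting {nv} {ne} {n} {N} Nw c x C F =
    (∀ e → tgt G e ≡ leaf Nw x → e ∈ F)
  ×
    (∀ e → e ∈ F → c e ∉ C)
  ×
    (∀ e → e ∈ F → ReachIn G (Endpoint G F) (tgt G e) (leaf Nw x))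
  ×
    (∃[ F' ] ((∀ e → e ∈ F' → c e ∈ C)
            × (∀ e e' → (e ∈ F ⊎ e ∈ F') → (e' ∈ F ⊎ e' ∈ F') → c e ≡ c e' → e ≡ e')
            × (∀ e → e ∈ F → ExactlyOne (Cond1 (src G e)) (Cond2 F' (src G e)))))
  where
    G = graph Nw
    Cond1 : Fin nv → Set
    Cond1 u = (∀ e → tgt G e ≡ u → e ∈ F) × (∀ e → src G e ≡ u → c e ∉ C)
    Cond2 : Subset ne → Fin nv → Set
    Cond2 F' u = (∀ e → tgt G e ≡ u → e ∉ F) × (∃[ e ] (src G e ≡ u × e ∈ F'))

-- Perfect triples (A, χ₁, χ₂); χᵢ only matters on A

Disjoint : ∀ {N} → Subset N → Subset N → Set
Disjoint S T = ∀ k → k ∈ S → k ∈ T → Data.Empty.⊥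
  where import Data.Empty

ColoursOf : ∀ {ne N} → (Fin ne → Fin N) → Subset ne → Subset N → Set
ColoursOf c F S = ∀ k → (k ∈ S → ∃[ e ] (e ∈ F × c e ≡ k)) × (∃[ e ] (e ∈ F × c e ≡ k) → k ∈ S)

Perfect : ∀ {nv ne n N} → PhyloNetwork nv ne n → (Fin ne → Fin N) →
          Subset n → (Fin n → Subset N) → (Fin n → Subset N) → Set
Perfect Nw c A χ₁ χ₂ =
    (∀ x y → x ∈ A → y ∈ A → x ≢ y → Disjoint (χ₁ x) (χ₁ y))
  × (∀ x y → x ∈ A → y ∈ A → x ≢ y → Disjoint (χ₂ x) (χ₂ y))
  × (∀ i j → i ∈ A → j ∈ A → F._≤_ i j → Disjoint (χ₁ i) (χ₂ j))
  × (∀ x → x ∈ A → ∃[ F ] (Respecting Nw c x (χ₂ x) F × ColoursOf c F (χ₁ x)))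

sumOver : ∀ {n} → Subset n → (Fin n → ℕ) → ℕ
sumOver {n} A f = sum (map (λ x → if lookup A x then f x else 0) (allFin n))

{-# OPTIONS --safe #-}
-- Write F_x for F_{x,χ₂(x)}.  Every edge that does not lie above a leaf of
-- X ∖ A belongs to some F_x with x ∈ A; hence the total weight is at most
-- PD(X ∖ A) + Σ_{x ∈ A} ω(F_x).  The covering is proved bottom-up
-- over the acyclic network.  If a child edge e' of e lies in F_x, condition
-- (iv) for e' either puts e into F_x, or yields a child edge e₂ of e whose
-- colour lies in χ₂(x).  In the second case e₂ lies in some F_y, and since
-- χ₁(y) = c(F_y) avoids χ₂(x) for y ≤ x, we must have y > x; so the step
-- repeats with a larger index and terminates.
module Submission where

open import Defs
open import Data.Nat using (ℕ; _≤_; _<_; _∸_)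
open import Data.Fin using (Fin)
open import Data.Fin.Subset using (Subset; _∈_; ∁)

open import Data.Nat.Properties
open import Algebra.Properties.CommutativeMonoid.Sum +-0-commutativeMonoid
  using (sum-syntax; ∑-comm; ∑-distrib-+; sum-cong-≗; sum-remove; sum-replicate-zero)
open import Data.Bool using (Bool; true; false; if_then_else_)
open import Data.Empty using (⊥-elim)
import Data.Fin as Fin
import Data.Fin.Properties as Finₚ
open import Data.Fin.Induction using (>-wellFounded; spo-wellFounded)
open import Data.Fin.Subset using (_∉_)
open import Data.Fin.Subset.Properties using (_∈?_; x∉p⇒x∈∁p)
open import Data.List using (length; allFin; map; tabulate)
open import Data.List.Properties using (map-tabulate; filter-none)
open import Data.List.Membership.Propositional.Properties using (∈-filter⁺; ∈-allFin; ∈-length)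
import Data.List.Relation.Unary.All as All
open import Data.Nat using (zero; suc; _+_; z≤n; s≤s)
open import Data.Nat.ListAction using (sum)
open import Data.Product using (Σ; ∃-syntax; _×_; _,_; proj₁; proj₂)
open import Data.Sum using (_⊎_; inj₁; inj₂)
open import Data.Vec using (lookup)
open import Data.Vec.Properties using ([]=⇒lookup)
open import Function using (_∘_)
open import Induction.WellFounded using (WellFounded; Acc; acc; module Subrelation)
open import Level using (0ℓ)
open import Relation.Binary using (Rel; IsStrictPartialOrder)
open import Relation.Binary.Construct.Closure.Transitive using (TransClosure; [_]; _∷_; _++_)
open import Relation.Binary.PropositionalEquality
open import Relation.Nullary using (¬_; yes; no)

sum-map-allFin : ∀ k (f : Fin k → ℕ) → sum (map f (allFin k)) ≡ ∑[ i < k ] f i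
sum-map-allFin k f = trans (cong sum (map-tabulate (λ i → i) f)) (sum-tabulate k f)
  where
  sum-tabulate : ∀ k (f : Fin k → ℕ) → sum (tabulate f) ≡ ∑[ i < k ] f i
  sum-tabulate zero    f = refl
  sum-tabulate (suc k) f = cong (f Fin.zero +_) (sum-tabulate k (f ∘ Fin.suc))

∑-mono-≤ : ∀ {k} {f g : Fin k → ℕ} → (∀ i → f i ≤ g i) → ∑[ i < k ] f i ≤ ∑[ i < k ] g i
∑-mono-≤ {zero}  f≤g = z≤n
∑-mono-≤ {suc k} f≤g = +-mono-≤ (f≤g Fin.zero) (∑-mono-≤ (f≤g ∘ Fin.suc))

term≤∑ : ∀ {k} (f : Fin k → ℕ) i → f i ≤ ∑[ j < k ] f j
term≤∑ {suc k} f i = ≤-trans (m≤m+n (f i) _) (≤-reflexive (sym (sum-remove {i = i} f)))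

_when_ : ℕ → Bool → ℕ
v when b = if b then v else 0

∑-when : ∀ {k} b (f : Fin k → ℕ) → (∑[ i < k ] f i) when b ≡ ∑[ i < k ] (f i when b)
∑-when {k} true  f = refl
∑-when {k} false f = sym (sum-replicate-zero k)

when-∈ : ∀ {k} {S : Subset k} {i} v → i ∈ S → v when lookup S i ≡ v
when-∈ v i∈S rewrite []=⇒lookup i∈S = refl

weight-cover : ∀ {n ne} (ω : Fin ne → ℕ) (A : Subset n) (Fs : Fin n → Subset ne) (S : Subset ne) →
  (∀ e → e ∈ S ⊎ ∃[ y ] (y ∈ A × e ∈ Fs y)) →
  totalWeight ω ≤ sumOver A (λ y → weight ω (Fs y)) + weight ω S
weight-cover {n} {ne} ω A Fs S covers = begin
  totalWeight ω                                   ≡⟨ sum-map-allFin ne ω ⟩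
  ∑[ e < ne ] ω e                                 ≤⟨ ∑-mono-≤ pointwise ⟩
  ∑[ e < ne ] (∑[ y < n ] inFs y e + inS e)       ≡⟨ ∑-distrib-+ (λ e → ∑[ y < n ] inFs y e) inS ⟩
  ∑[ e < ne ] ∑[ y < n ] inFs y e + ∑[ e < ne ] inS e
                                                  ≡⟨ cong₂ _+_ (∑-comm (λ e y → inFs y e)) (sym (sum-map-allFin ne inS)) ⟩
  ∑[ y < n ] ∑[ e < ne ] inFs y e + weight ω S    ≡⟨ cong (_+ weight ω S) (sym Fs-sum) ⟩
  sumOver A (λ y → weight ω (Fs y)) + weight ω S  ∎
  where
  open ≤-Reasoning
  inF inFs : Fin n → Fin ne → ℕ
  inF y e = ω e when lookup (Fs y) e
  inFs y e = inF y e when lookup A y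
  inS : Fin ne → ℕ
  inS e = ω e when lookup S e
  pointwise : ∀ e → ω e ≤ ∑[ y < n ] inFs y e + inS e
  pointwise e with covers e
  ... | inj₁ e∈S = ≤-trans (≤-reflexive (sym (when-∈ (ω e) e∈S))) (m≤n+m (inS e) _)
  ... | inj₂ (y , y∈A , e∈Fy) = begin
    ω e                    ≡⟨ sym (trans (when-∈ _ y∈A) (when-∈ (ω e) e∈Fy)) ⟩
    inFs y e               ≤⟨ term≤∑ (λ y → inFs y e) y ⟩
    ∑[ y < n ] inFs y e    ≤⟨ m≤m+n _ (inS e) ⟩
    ∑[ y < n ] inFs y e + inS e ∎
  Fs-sum : sumOver A (λ y → weight ω (Fs y)) ≡ ∑[ y < n ] ∑[ e < ne ] inFs y e
  Fs-sum = trans (sum-map-allFin n (λ y → weight ω (Fs y) when lookup A y)) (sum-cong-≗ λ y →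
    trans (cong (_when lookup A y) (sum-map-allFin ne (inF y))) (∑-when (lookup A y) (inF y)))

module _ {nv ne} (G : Digraph nv ne) where

  _◁_ : Rel (Fin ne) 0ℓ
  e' ◁ e = src G e' ≡ tgt G e

  reach-snoc : ∀ {u e} → Reach G u (src G e) → Reach G u (tgt G e)
  reach-snoc {e = e} reach-refl        = reach-step e refl reach-refl
  reach-snoc         (reach-step d p r) = reach-step d p (reach-snoc r)

  ◁⁺⇒reach : ∀ {e' e} → TransClosure _◁_ e' e → Reach G (tgt G e) (src G e')
  ◁⁺⇒reach [ e'◁e ]       = subst (Reach G _) (sym e'◁e) reach-refl
  ◁⁺⇒reach (e'◁d ∷ d◁⁺e) = subst (Reach G _) (sym e'◁d) (reach-snoc (◁⁺⇒reach d◁⁺e))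

  ◁-wellFounded : (∀ e → ¬ Reach G (tgt G e) (src G e)) → WellFounded _◁_
  ◁-wellFounded acyclic =
    Subrelation.wellFounded [_] (spo-wellFounded ◁⁺-isStrictPartialOrder)
    where
    ◁⁺-isStrictPartialOrder : IsStrictPartialOrder _≡_ (TransClosure _◁_)
    ◁⁺-isStrictPartialOrder = record
      { isEquivalence = isEquivalence
      ; irrefl        = λ { {e} refl e◁⁺e → acyclic e (◁⁺⇒reach e◁⁺e) }
      ; trans         = _++_
      ; <-resp-≈      = resp₂ (TransClosure _◁_)
      }

  indeg-pos : ∀ e → 0 < indeg G (tgt G e)
  indeg-pos e = ∈-length (∈-filter⁺ (λ d → tgt G d Fin.≟ tgt G e) (∈-allFin e) refl)

  outdeg-zero : ∀ v → (∀ e → src G e ≢ v) → outdeg G v ≡ 0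
  outdeg-zero v none =
    cong length (filter-none (λ e → src G e Fin.≟ v) {xs = allFin ne} (All.tabulate (λ {e} _ → none e)))

module _ {nv ne n} (Nw : PhyloNetwork nv ne n) where

  private
    G : Digraph nv ne
    G = graph Nw

  sink⇒leaf : ∀ v → v ≢ root Nw → outdeg G v ≡ 0 → ∃[ x ] leaf Nw x ≡ v
  sink⇒leaf v v≢root outdeg≡0 with kinds Nw v v≢root
  ... | inj₁ (indeg≡1 , _)          = leaf-onto Nw v indeg≡1 outdeg≡0
  ... | inj₂ (inj₁ (_ , 2≤outdeg)) = ⊥-elim (<⇒≱ (s≤s z≤n) (subst (2 ≤_) outdeg≡0 2≤outdeg))
  ... | inj₂ (inj₂ (_ , outdeg≡1)) = ⊥-elim (0≢1+n (trans (sym outdeg≡0) outdeg≡1))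

  childless⇒leaf : ∀ e → (∀ e' → ¬ (_◁_ G e' e)) → ∃[ x ] leaf Nw x ≡ tgt G e
  childless⇒leaf e childless = sink⇒leaf (tgt G e) ≢root (outdeg-zero G (tgt G e) childless)
    where
    ≢root : tgt G e ≢ root Nw
    ≢root tgt≡root = <⇒≢ (subst (λ v → 0 < indeg G v) tgt≡root (indeg-pos G e)) (sym (root-indeg Nw))

  respecting-step : ∀ {N} {c : Fin ne → Fin N} {x C F e'} → Respecting Nw c x C F → e' ∈ F →
    (∀ e → _◁_ G e' e → e ∈ F) ⊎ ∃[ e₂ ] (src G e₂ ≡ src G e' × c e₂ ∈ C)
  respecting-step (_ , _ , _ , F' , F'-coloured , _ , conditions) e'∈F with conditions _ e'∈F
  ... | inj₁ ((parents∈F , _) , _)        = inj₁ (λ e e'◁e → parents∈F e (sym e'◁e))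
  ... | inj₂ (_ , _ , e₂ , sibling , e₂∈F') = inj₂ (e₂ , sibling , F'-coloured e₂ e₂∈F')

-- The sets Fs x of the hypothesis and the witnesses Gs x of perfection are
-- tracked together, since uniqueness of F_{x,C} is not available.
module Covering {nv ne n N} (Nw : PhyloNetwork nv ne n) (c : Fin ne → Fin N)
  (A : Subset n) (χ₁ χ₂ : Fin n → Subset N) (perfect : Perfect Nw c A χ₁ χ₂)
  (Fs : Fin n → Subset ne) (Fs-respecting : ∀ x → x ∈ A → Respecting Nw c x (χ₂ x) (Fs x))
  (S : Subset ne) (S-pd : IsPDEdgeSet Nw (∁ A) S) where

  private
    G : Digraph nv ne
    G = graph Nw

    _◁ᴳ_ : Rel (Fin ne) 0ℓ
    _◁ᴳ_ = _◁_ G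

    χ₁-χ₂-disjoint : ∀ i j → i ∈ A → j ∈ A → i Fin.≤ j → Disjoint (χ₁ i) (χ₂ j)
    χ₁-χ₂-disjoint = proj₁ (proj₂ (proj₂ perfect))

    witness : ∀ x → x ∈ A → ∃[ F ] (Respecting Nw c x (χ₂ x) F × ColoursOf c F (χ₁ x))
    witness = proj₂ (proj₂ (proj₂ perfect))

  Gs : ∀ x → x ∈ A → Subset ne
  Gs x x∈A = proj₁ (witness x x∈A)

  Gs-respecting : ∀ x (x∈A : x ∈ A) → Respecting Nw c x (χ₂ x) (Gs x x∈A)
  Gs-respecting x x∈A = proj₁ (proj₂ (witness x x∈A))

  Gs-colours : ∀ x (x∈A : x ∈ A) → ColoursOf c (Gs x x∈A) (χ₁ x)
  Gs-colours x x∈A = proj₂ (proj₂ (witness x x∈A))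

  Covered : Fin ne → Set
  Covered e = ∃[ y ] Σ (y ∈ A) λ y∈A → e ∈ Fs y × e ∈ Gs y y∈A

  ∉S-child : ∀ {e' e} → e' ◁ᴳ e → e ∉ S → e' ∉ S
  ∉S-child e'◁e e∉S e'∈S with proj₁ (S-pd _) e'∈S
  ... | y , y∈∁A , reach = e∉S (proj₂ (S-pd _) (y , y∈∁A , reach-step _ e'◁e reach))

  coloured-index-increases : ∀ {x y e₂} (x∈A : x ∈ A) (y∈A : y ∈ A) →
    e₂ ∈ Gs y y∈A → c e₂ ∈ χ₂ x → x Fin.< y
  coloured-index-increases {x} {y} {e₂} x∈A y∈A e₂∈Gy ce₂∈χ₂x with y Finₚ.≤? x
  ... | yes y≤x = ⊥-elim (χ₁-χ₂-disjoint y x y∈A x∈A y≤x (c e₂) ce₂∈χ₁y ce₂∈χ₂x)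
    where
    ce₂∈χ₁y : c e₂ ∈ χ₁ y
    ce₂∈χ₁y = proj₂ (Gs-colours y y∈A (c e₂)) (e₂ , e₂∈Gy , refl)
  ... | no y≰x = ≰⇒> y≰x

  module _ {e} (e∉S : e ∉ S) (children-covered : ∀ {e'} → e' ◁ᴳ e → e' ∉ S → Covered e') where

    mutual
      parent-covered : ∀ {x} → Acc Fin._>_ x → (x∈A : x ∈ A) → ∀ {e'} → e' ◁ᴳ e →
                       e' ∈ Fs x → e' ∈ Gs x x∈A → Covered e
      parent-covered {x} rec x∈A e'◁e e'∈Fx e'∈Gx
        with respecting-step Nw (Fs-respecting x x∈A) e'∈Fx
           | respecting-step Nw (Gs-respecting x x∈A) e'∈Gx
      ... | inj₁ parents∈Fx | inj₁ parents∈Gx = x , x∈A , parents∈Fx e e'◁e , parents∈Gx e e'◁e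
      ... | inj₂ (e₂ , sibling , coloured) | _ =
        coloured-child-covered rec x∈A (trans sibling e'◁e) coloured
      ... | inj₁ _ | inj₂ (e₂ , sibling , coloured) =
        coloured-child-covered rec x∈A (trans sibling e'◁e) coloured

      coloured-child-covered : ∀ {x} → Acc Fin._>_ x → x ∈ A → ∀ {e₂} → e₂ ◁ᴳ e →
                               c e₂ ∈ χ₂ x → Covered e
      coloured-child-covered (acc larger) x∈A e₂◁e coloured
        with children-covered e₂◁e (∉S-child e₂◁e e∉S)
      ... | y , y∈A , e₂∈Fy , e₂∈Gy =
        parent-covered (larger (coloured-index-increases x∈A y∈A e₂∈Gy coloured)) y∈A e₂◁e e₂∈Fy e₂∈Gy

    covered-from-children : Covered e
    covered-from-children with Finₚ.any? (λ e' → src G e' Fin.≟ tgt G e)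
    ... | yes (e₀ , e₀◁e) with children-covered e₀◁e (∉S-child e₀◁e e∉S)
    ...   | y , y∈A , e₀∈Fy , e₀∈Gy = parent-covered (>-wellFounded y) y∈A e₀◁e e₀∈Fy e₀∈Gy
    covered-from-children | no childless with childless⇒leaf Nw e (λ e' e'◁e → childless (e' , e'◁e))
    ... | x , leaf≡tgt with x ∈? A
    ... | yes x∈A = x , x∈A , proj₁ (Fs-respecting x x∈A) e (sym leaf≡tgt)
                            , proj₁ (Gs-respecting x x∈A) e (sym leaf≡tgt)
    ... | no x∉A = ⊥-elim (e∉S (proj₂ (S-pd e) (x , x∉p⇒x∈∁p x∉A , reach-leaf)))
      where
      reach-leaf : Reach G (tgt G e) (leaf Nw x)
      reach-leaf = subst (Reach G _) (sym leaf≡tgt) reach-refl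

  ∉S-covered : ∀ {e} → Acc _◁ᴳ_ e → e ∉ S → Covered e
  ∉S-covered (acc smaller) e∉S = covered-from-children e∉S (λ e'◁e → ∉S-covered (smaller e'◁e))

  cover : ∀ e → e ∈ S ⊎ ∃[ y ] (y ∈ A × e ∈ Fs y)
  cover e with e ∈? S
  ... | yes e∈S = inj₁ e∈S
  ... | no e∉S with ∉S-covered (◁-wellFounded G (acyclic Nw) e) e∉S
  ...   | y , y∈A , e∈Fy , _ = inj₂ (y , y∈A , e∈Fy)

lemma3p6 : ∀ {nv ne n : ℕ} (Nw : PhyloNetwork nv ne n)
    (fw : FoodWeb n) → IsFoodWeb fw →
    (T : RootedTree n) → IsTreeExtension fw T → IsDFSOrder T →
    (N : ℕ) → 0 < N → (c : Fin ne → Fin N) →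
    (A : Subset n) (χ₁ χ₂ : Fin n → Subset N) → Perfect Nw c A χ₁ χ₂ →
    (Fs : Fin n → Subset ne) → (∀ x → x ∈ A → Respecting Nw c x (χ₂ x) (Fs x)) →
    (S : Subset ne) → IsPDEdgeSet Nw (∁ A) S →
    totalWeight (ω Nw) ∸ sumOver A (λ x → weight (ω Nw) (Fs x)) ≤ weight (ω Nw) S
lemma3p6 Nw _ _ _ _ _ _ _ c A χ₁ χ₂ perfect Fs Fs-respecting S S-pd =
  m≤n+o⇒m∸n≤o _ _
    (weight-cover (ω Nw) A Fs S (Covering.cover Nw c A χ₁ χ₂ perfect Fs Fs-respecting S S-pd))
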